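{- Let $D$ be a digraph without parallel edges, let $X\subseteq E(D)$, and let $\lambda_1:E(D)\setminus X\to S$ and $\lambda_2:X\to S$ be functions to a set $S$ with $k$ elements. If the partition $(E(D)\setminus X,X)$ of $V(\vec{L}(D))=E(D)$ is $(\lambda_1,\lambda_2)$-consistent in $\vec{L}(D)$, then $|S_X^V|\leq 4k$, i.e. the edge-partition $(E(D)\setminus X,X)$ has directed order at most $4k$ in $D$.
   Context: All digraphs are finite and loopless; $\vec{xy}$ denotes the directed edge from $x$ to $y$. A digraph has no parallel edges if no two distinct edges have the same set of endpoints. Directed line-graph: $\vec{L}(D)$ has vertex set $E(D)$ and an edge $\vec{ef}$ whenever there are vertices $w,x,y$ of $D$ with $e=\vec{wx}$ and $f=\vec{xy}$. For $B\subseteq E(D)$, $S_B^V=\{y\in V(D): \exists x,z \text{ with } \vec{xy}\in E(D)\setminus B,\ \vec{yz}\in B\}$; the directed order of the edge-partition $(E(D)\setminus B,B)$ is $|S_B^V|$. Consistency: for a digraph $G$, a partition $(A,B)$ of $V(G)$ and functions $\lambda_A:A\to S$, $\lambda_B:B\to S$, the partition $(A,B)$ is $(\lambda_A,\lambda_B)$-consistent if both of the following hold: (i) whenever $a_1,a_2\in A$ satisfy $\lambda_A(a_1)=\lambda_A(a_2)$ and $b\in B$, we have $\vec{a_1b}\in E(G)\iff\vec{a_2b}\in E(G)$; (ii) whenever $b_1,b_2\in B$ satisfy $\lambda_B(b_1)=\lambda_B(b_2)$ and $a\in A$, we have $\vec{ab_1}\in E(G)\iff\vec{ab_2}\in E(G)$.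 -}

module Defs where

open import Data.Nat using (ℕ)
open import Data.Bool using (Bool; true; false; _∧_; not; T)
open import Data.Fin using (Fin)
open import Data.Fin.Subset using (Subset)
open import Data.Vec using (tabulate)
open import Data.List using (allFin)
open import Data.Bool.ListAction using (any)
open import Data.Product using (Σ; _×_)
open import Data.Empty using (⊥)
open import Function.Bundles using (_⇔_)
open import Relation.Binary.PropositionalEquality using (_≡_)

record Digraph : Set where
  field
    n          : ℕ
    adj        : Fin n → Fin n → Bool
    loopless   : ∀ x → adj x x ≡ false
    noParallel : ∀ x y → T (adj x y) → T (adj y x) → ⊥

open Digraph public

record Edge (D : Digraph) : Set where
  constructor edge
  field
    tl     : Fin (n D)
    hd     : Fin (n D)
    isEdge : T (adj D tl hd)

open Edge public

LineAdj : (D : Digraph) → Edge D → Edge D → Set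
LineAdj D e f = hd e ≡ tl f

-- (λ_A, λ_B)-consistency of a partition (A, B) of the vertex set V of a
-- digraph with edge relation E; A is the set of v with inA v = true and
-- B the set of v with inA v = false.
Consistent : {V : Set} (E : V → V → Set) (inA : V → Bool) {S : Set}
  → (Σ V (λ v → T (inA v)) → S) → (Σ V (λ v → T (not (inA v))) → S) → Set
Consistent {V} E inA λA λB =
  (∀ (a₁ a₂ : Σ V (λ v → T (inA v))) (b : Σ V (λ v → T (not (inA v))))
     → λA a₁ ≡ λA a₂ → E (Σ.proj₁ a₁) (Σ.proj₁ b) ⇔ E (Σ.proj₁ a₂) (Σ.proj₁ b))
  × (∀ (b₁ b₂ : Σ V (λ v → T (not (inA v)))) (a : Σ V (λ v → T (inA v)))
     → λB b₁ ≡ λB b₂ → E (Σ.proj₁ a) (Σ.proj₁ b₁) ⇔ E (Σ.proj₁ a) (Σ.proj₁ b₂))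

-- S_X^V for X ⊆ E(D) given as a Boolean predicate on vertex pairs:
-- y such that some edge x→y is not in X and some edge y→z is in X.
SXV : (D : Digraph) → (Fin (n D) → Fin (n D) → Bool) → Subset (n D)
SXV D X = tabulate λ y →
  any (λ x → adj D x y ∧ not (X x y)) (allFin (n D))
  ∧ any (λ z → adj D y z ∧ X y z) (allFin (n D))

-- For y ∈ S_X^V pick an edge a_y = xy ∉ X and an edge b_y = yz ∈ X; then a_y b_y is an
-- edge of L(D). If λ₁(a_y) = λ₁(a_y′), consistency turns it into an edge a_y′ b_y, so
-- y′ = head(a_y′) = tail(b_y) = y. Hence y ↦ λ₁(a_y) is injective on S_X^V and in fact
-- |S_X^V| ≤ k.
module Submission where

open import Defs
open import Data.Nat using (ℕ; _≤_; _*_; zero; suc; z≤n; s≤s)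
open import Data.Nat.Properties using (≤-trans; m≤n*m)
open import Data.Bool using (Bool; true; false; not; T; _∧_)
open import Data.Bool.Properties using (T-∧; T-≡; not-involutive)
open import Data.Fin using (Fin; punchOut)
open import Data.Fin.Properties using (punchOut-injective; suc-injective)
open import Data.Fin.Subset using (Subset; _∈_; ∣_∣)
open import Data.Vec using ([]; _∷_; here; there)
open import Data.Vec.Properties using ([]=⇒lookup; lookup∘tabulate)
open import Data.List using (allFin)
open import Data.Bool.ListAction using (any)
open import Data.List.Relation.Unary.Any using (satisfied)
open import Data.List.Relation.Unary.Any.Properties using (any⁻)
open import Data.Product using (Σ; _,_; proj₁; proj₂; _×_)
open import Function.Bundles using (Equivalence)
open import Relation.Binary.PropositionalEquality using (_≡_; _≢_; refl; sym; trans; subst; module ≡-Reasoning)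

injective⇒∣p∣≤ : ∀ {n k} (p : Subset n) (f : ∀ {y} → y ∈ p → Fin k)
  → (∀ {y y′} (y∈p : y ∈ p) (y′∈p : y′ ∈ p) → f y∈p ≡ f y′∈p → y ≡ y′)
  → ∣ p ∣ ≤ k
injective⇒∣p∣≤ []            f f-inj = z≤n
injective⇒∣p∣≤ (false ∷ p)   f f-inj =
  injective⇒∣p∣≤ p (λ y∈p → f (there y∈p))
    (λ y∈p y′∈p eq → suc-injective (f-inj (there y∈p) (there y′∈p) eq))
injective⇒∣p∣≤ {k = zero}  (true ∷ p) f f-inj with () ← f here
injective⇒∣p∣≤ {k = suc k} (true ∷ p) f f-inj = s≤s (injective⇒∣p∣≤ p g g-inj)
  where
  f₀≢ : ∀ {y} (y∈p : y ∈ p) → f here ≢ f (there y∈p)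
  f₀≢ y∈p eq with () ← f-inj here (there y∈p) eq

  g : ∀ {y} → y ∈ p → Fin k
  g y∈p = punchOut (f₀≢ y∈p)

  g-inj : ∀ {y y′} (y∈p : y ∈ p) (y′∈p : y′ ∈ p) → g y∈p ≡ g y′∈p → y ≡ y′
  g-inj y∈p y′∈p eq =
    suc-injective (f-inj (there y∈p) (there y′∈p) (punchOut-injective (f₀≢ y∈p) (f₀≢ y′∈p) eq))

module _ {D : Digraph} {X : Fin (n D) → Fin (n D) → Bool} where

  EdgeOutside EdgeInside : Set
  EdgeOutside = Σ (Edge D) (λ e → T (not (X (tl e) (hd e))))
  EdgeInside  = Σ (Edge D) (λ e → T (not (not (X (tl e) (hd e)))))

  enteredOutsideX leftInsideX : Fin (n D) → Fin (n D) → Bool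
  enteredOutsideX y x = adj D x y ∧ not (X x y)
  leftInsideX     y z = adj D y z ∧ X y z

  ∈SXV⇒ : ∀ {y} → y ∈ SXV D X
    → T (any (enteredOutsideX y) (allFin (n D))) × T (any (leftInsideX y) (allFin (n D)))
  ∈SXV⇒ {y} y∈S = Equivalence.to T-∧
    (Equivalence.from T-≡ (trans (sym (lookup∘tabulate _ y)) ([]=⇒lookup y∈S)))

  enteringEdge : ∀ {y} → y ∈ SXV D X → Σ EdgeOutside (λ a → hd (proj₁ a) ≡ y)
  enteringEdge {y} y∈S =
    let x , xy∉X = satisfied (any⁻ (enteredOutsideX y) (allFin (n D)) (proj₁ (∈SXV⇒ y∈S)))
        xy∈E , ∉X = Equivalence.to T-∧ xy∉X
    in (edge x y xy∈E , ∉X) , refl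

  leavingEdge : ∀ {y} → y ∈ SXV D X → Σ EdgeInside (λ b → tl (proj₁ b) ≡ y)
  leavingEdge {y} y∈S =
    let z , yz∈X = satisfied (any⁻ (leftInsideX y) (allFin (n D)) (proj₂ (∈SXV⇒ y∈S)))
        yz∈E , ∈X = Equivalence.to T-∧ yz∈X
    in (edge y z yz∈E , subst T (sym (not-involutive _)) ∈X) , refl

  module _ {k : ℕ} (λ₁ : EdgeOutside → Fin k) (λ₂ : EdgeInside → Fin k) where

    enteringLabel : ∀ {y} → y ∈ SXV D X → Fin k
    enteringLabel y∈S = λ₁ (proj₁ (enteringEdge y∈S))

    enteringLabel-injective : Consistent (LineAdj D) (λ e → not (X (tl e) (hd e))) λ₁ λ₂
      → ∀ {y y′} (y∈S : y ∈ SXV D X) (y′∈S : y′ ∈ SXV D X)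
      → enteringLabel y∈S ≡ enteringLabel y′∈S → y ≡ y′
    enteringLabel-injective (consistent , _) {y} {y′} y∈S y′∈S same = sym (begin
      y′             ≡⟨ sym (proj₂ (enteringEdge y′∈S)) ⟩
      hd (proj₁ a′)  ≡⟨ Equivalence.to (consistent a a′ b same) a→b ⟩
      tl (proj₁ b)   ≡⟨ proj₂ (leavingEdge y∈S) ⟩
      y              ∎)
      where
      open ≡-Reasoning
      a a′ : EdgeOutside
      a  = proj₁ (enteringEdge y∈S)
      a′ = proj₁ (enteringEdge y′∈S)
      b : EdgeInside
      b = proj₁ (leavingEdge y∈S)
      a→b : LineAdj D (proj₁ a) (proj₁ b)
      a→b = trans (proj₂ (enteringEdge y∈S)) (sym (proj₂ (leavingEdge y∈S)))

mainTheorem13 : (D : Digraph) (X : Fin (n D) → Fin (n D) → Bool)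
    → (∀ x y → T (X x y) → T (adj D x y))
    → (k : ℕ)
    → (λ₁ : Σ (Edge D) (λ e → T (not (X (tl e) (hd e)))) → Fin k)
    → (λ₂ : Σ (Edge D) (λ e → T (not (not (X (tl e) (hd e))))) → Fin k)
    → Consistent (LineAdj D) (λ e → not (X (tl e) (hd e))) λ₁ λ₂
    → ∣ SXV D X ∣ ≤ 4 * k
mainTheorem13 D X _ k λ₁ λ₂ consistent =
  ≤-trans (injective⇒∣p∣≤ (SXV D X) (enteringLabel λ₁ λ₂)
                                    (enteringLabel-injective λ₁ λ₂ consistent))
          (m≤n*m k 4)
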